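{- Let $A\subset\mathbb{Z}$ be a finite set which is the union of $s$ segments $P_1,\dots,P_s$, with $1\le s\le |A|-1$. Let $S_A$ be the integer matrix with $s$ columns whose rows are all vectors $\mathbf e_{j_1}+\mathbf e_{j_2}-\mathbf e_{j_3}-\mathbf e_{j_4}\in\mathbb{Z}^s$ (with $j_1,j_2,j_3,j_4\in\{1,\dots,s\}$, not all equal) such that $(P_{j_1}+P_{j_2})\cap(P_{j_3}+P_{j_4})\neq\emptyset$, where $\mathbf e_j$ denotes the $j$-th standard basis vector. Then $$\dim(A)=s-\mathrm{rank}(S_A).$$
   Context: A segment is a set of consecutive integers $[m,n]=\{m,\dots,n\}$. A set $A\subset\mathbb{Z}$ is the union of $s$ segments if $A=P_1\cup\dots\cup P_s$ where each $P_i$ is a segment of length $k_i$, $\max P_i+1<\min P_{i+1}$ for $1\le i<s$, and $k_i>1$ for some $i$. Two sets $A\subset G$, $B\subset G'$ in abelian groups are Freiman isomorphic of order 2 if there is a bijection $\phi:A\to B$ with $x+y=z+t \iff \phi(x)+\phi(y)=\phi(z)+\phi(t)$ for all $x,y,z,t\in A$. The dimension $\dim(A)$ is the largest $d$ such that some $B\subset\mathbb{Z}^d$ not contained in a hyperplane is Freiman isomorphic of order 2 to $A$. -}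

module Defs where

open import Data.Nat as ℕ using (ℕ; suc)
open import Data.Integer as ℤ using (ℤ; 0ℤ; 1ℤ; _+_; _-_; _*_; _≤_; _<_; ∣_∣)
open import Data.Fin using (Fin; toℕ; _≟_)
open import Data.Vec using (Vec; tabulate; zipWith; replicate; foldr; sum)
open import Data.Product using (Σ; ∃; ∃-syntax; _×_)
open import Relation.Nullary using (¬_; does)
open import Data.Bool using (if_then_else_)
open import Relation.Binary.PropositionalEquality using (_≡_)
open import Level using () renaming (suc to lsuc; zero to lzero)

_⊕_ : ∀ {d} → Vec ℤ d → Vec ℤ d → Vec ℤ d
_⊕_ = zipWith _+_

_⊖_ : ∀ {d} → Vec ℤ d → Vec ℤ d → Vec ℤ d
_⊖_ = zipWith _-_

_·_ : ∀ {d} → Vec ℤ d → Vec ℤ d → ℤ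
u · v = foldr _ _+_ 0ℤ (zipWith _*_ u v)

zeroV : ∀ {d} → Vec ℤ d
zeroV = replicate _ 0ℤ

_⊛_ : ∀ {d} → ℤ → Vec ℤ d → Vec ℤ d
c ⊛ v = Data.Vec.map (c *_) v

e : ∀ {s} → Fin s → Vec ℤ s
e j = tabulate (λ i → if does (i ≟ j) then 1ℤ else 0ℤ)

-- A union of s segments P_i = [m i, n i] ⊂ ℤ

record SegmentUnion (s : ℕ) : Set where
  field
    m n     : Fin s → ℤ
    m≤n     : ∀ i → m i ≤ n i
    gaps    : ∀ (i j : Fin s) → toℕ j ≡ suc (toℕ i) → n i + 1ℤ < m j
    somelong : ∃[ i ] (m i < n i)

module _ {s : ℕ} (U : SegmentUnion s) where
  open SegmentUnion U

  InP : Fin s → ℤ → Set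
  InP i x = m i ≤ x × x ≤ n i

  InA : ℤ → Set
  InA x = ∃[ i ] InP i x

  card : ℕ
  card = sum (tabulate (λ i → suc ∣ n i - m i ∣))

  RowSA : Vec ℤ s → Set
  RowSA v = ∃[ j₁ ] ∃[ j₂ ] ∃[ j₃ ] ∃[ j₄ ]
      (¬ (j₁ ≡ j₂ × j₂ ≡ j₃ × j₃ ≡ j₄))
    × (∃[ a₁ ] ∃[ a₂ ] ∃[ a₃ ] ∃[ a₄ ]
         (InP j₁ a₁ × InP j₂ a₂ × InP j₃ a₃ × InP j₄ a₄ × a₁ + a₂ ≡ a₃ + a₄))
    × v ≡ ((e j₁ ⊕ e j₂) ⊖ e j₃) ⊖ e j₄

-- Linear (in)dependence and rank (over ℤ, equivalently over ℚ)

linComb : ∀ {k s} → Vec ℤ k → (Fin k → Vec ℤ s) → Vec ℤ s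
linComb {s = s} c w = foldr _ _⊕_ zeroV (tabulate (λ i → Data.Vec.lookup c i ⊛ w i))

LinIndep : ∀ {k s} → (Fin k → Vec ℤ s) → Set
LinIndep {k} w = ∀ (c : Vec ℤ k) → linComb c w ≡ zeroV → c ≡ zeroV

IsRank : ∀ {s} → (Vec ℤ s → Set) → ℕ → Set
IsRank {s} R r =
    (∃[ w ] ((∀ (i : Fin r) → R (w i)) × LinIndep w))
  × (∀ (w : Fin (suc r) → Vec ℤ s) → (∀ i → R (w i)) → ¬ LinIndep w)

FreimanIso2 : ∀ {d} → (ℤ → Set) → (Vec ℤ d → Set) → (ℤ → Vec ℤ d) → Set
FreimanIso2 A B φ =
    (∀ x → A x → B (φ x))
  × (∀ x y → A x → A y → φ x ≡ φ y → x ≡ y)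
  × (∀ b → B b → ∃[ x ] (A x × φ x ≡ b))
  × (∀ x y z t → A x → A y → A z → A t →
       ((x + y ≡ z + t) → (φ x ⊕ φ y ≡ φ z ⊕ φ t))
     × ((φ x ⊕ φ y ≡ φ z ⊕ φ t) → (x + y ≡ z + t)))

-- B lies in an (affine) hyperplane {x : c·x = c₀}, c ≠ 0
-- (integer coefficients; for subsets of ℤ^d equivalent to real ones)
InHyperplane : ∀ {d} → (Vec ℤ d → Set) → Set
InHyperplane {d} B = ∃[ c ] ∃[ c₀ ] (¬ c ≡ zeroV × (∀ b → B b → c · b ≡ c₀))

Realizable : (ℤ → Set) → ℕ → Set₁
Realizable A d = Σ (Vec ℤ d → Set) λ B → ¬ InHyperplane B × ∃[ φ ] FreimanIso2 A B φ

IsDim : (ℤ → Set) → ℕ → Set₁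
IsDim A d = Realizable A d × (∀ d' → Realizable A d' → d' ℕ.≤ d)

-- Call a weight t : {1,…,s} → ℤ on the segments *respecting* A if every
-- additive relation a₁ + a₂ = a₃ + a₄ with aₖ ∈ P_{jₖ} gives
-- t_{j₁} + t_{j₂} = t_{j₃} + t_{j₄}.  Respecting weights are exactly the
-- vectors orthogonal to the rows of S_A; the all-ones vector 𝟙 is one of them.
--
-- Lower bound.  Take a maximal independent family w of r rows of S_A and
-- choose, by solving homogeneous systems, s − r − 1 nonzero pairwise
-- orthogonal vectors orthogonal to 𝟙 and to w.  They respect A, and
-- x ↦ (x, their values at the segment of x) is a Freiman isomorphism onto a
-- set spanning ℤ^{s−r}.
-- Upper bound.  A Freiman isomorphism φ : A → B ⊂ ℤ^d is affine on every
-- segment with a common slope; if d > s − r a nonzero solution of a small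
-- homogeneous system yields a hyperplane containing B.

module Submission where

open import Defs
open import Data.Nat as ℕ using (ℕ; zero; suc; _≤_; _∸_; s≤s; z≤n)
import Data.Nat.Properties as ℕP
open import Data.Integer as ℤ using (ℤ; 0ℤ; 1ℤ; -1ℤ; +_; -[1+_]; -_; _+_; _-_; _*_)
import Data.Integer.Properties as ℤP
open import Data.Integer.Tactic.RingSolver using (solve-∀)
open import Data.Fin using (Fin; zero; suc)
import Data.Fin.Properties as FinP
open import Data.Vec as V using (Vec; []; _∷_; _++_; lookup; tabulate; replicate)
import Data.Vec.Properties as VP
open import Data.List as L using (List)
open import Data.List.Relation.Unary.All as All using (All; []; _∷_)
import Data.List.Relation.Unary.All.Properties as AllP
import Data.List.Properties as LP
open import Data.Product using (Σ; ∃-syntax; _×_; _,_; proj₁; proj₂)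
open import Data.Sum using (inj₁; inj₂; [_,_]′)
open import Function using (id)
open import Data.Empty using (⊥-elim)
open import Relation.Nullary using (¬_; yes; no)
open import Relation.Nullary.Decidable using (_×-dec_)
open import Relation.Binary.PropositionalEquality
open import Algebra.Bundles using (AbelianGroup)
open import Algebra.Properties.Group (AbelianGroup.group ℤP.+-0-abelianGroup)
  using () renaming (∙-cancelʳ to +-cancelʳ)

vec-ext : ∀ {n} {u v : Vec ℤ n} → (∀ i → lookup u i ≡ lookup v i) → u ≡ v
vec-ext {u = u} {v} eq =
  trans (sym (VP.tabulate∘lookup u)) (trans (VP.tabulate-cong eq) (VP.tabulate∘lookup v))

vec-ext-zero : ∀ {n} {u : Vec ℤ n} → (∀ i → lookup u i ≡ 0ℤ) → u ≡ zeroV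
vec-ext-zero eq = vec-ext λ i → trans (eq i) (sym (VP.lookup-replicate i 0ℤ))

dot-zeroʳ : ∀ {n} (u : Vec ℤ n) → u · zeroV ≡ 0ℤ
dot-zeroʳ [] = refl
dot-zeroʳ (a ∷ u) rewrite dot-zeroʳ u | ℤP.*-zeroʳ a = refl

dot-comm : ∀ {n} (u v : Vec ℤ n) → u · v ≡ v · u
dot-comm [] [] = refl
dot-comm (a ∷ u) (b ∷ v) rewrite dot-comm u v | ℤP.*-comm a b = refl

dot-zeroˡ : ∀ {n} (u : Vec ℤ n) → zeroV · u ≡ 0ℤ
dot-zeroˡ u = trans (dot-comm zeroV u) (dot-zeroʳ u)

dot-⊕ʳ : ∀ {n} (u v w : Vec ℤ n) → u · (v ⊕ w) ≡ u · v + u · w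
dot-⊕ʳ [] [] [] = refl
dot-⊕ʳ (a ∷ u) (b ∷ v) (c ∷ w) rewrite dot-⊕ʳ u v w = ring a b c (u · v) (u · w)
  where
  ring : ∀ a b c x y → a * (b + c) + (x + y) ≡ (a * b + x) + (a * c + y)
  ring = solve-∀

dot-⊖ʳ : ∀ {n} (u v w : Vec ℤ n) → u · (v ⊖ w) ≡ u · v - u · w
dot-⊖ʳ [] [] [] = refl
dot-⊖ʳ (a ∷ u) (b ∷ v) (c ∷ w) rewrite dot-⊖ʳ u v w = ring a b c (u · v) (u · w)
  where
  ring : ∀ a b c x y → a * (b - c) + (x - y) ≡ (a * b + x) - (a * c + y)
  ring = solve-∀

dot-⊛ʳ : ∀ {n} (u : Vec ℤ n) c v → u · (c ⊛ v) ≡ c * (u · v)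
dot-⊛ʳ [] c [] = sym (ℤP.*-zeroʳ c)
dot-⊛ʳ (a ∷ u) c (b ∷ v) rewrite dot-⊛ʳ u c v = ring a b c (u · v)
  where
  ring : ∀ a b c x → a * (c * b) + c * x ≡ c * (a * b + x)
  ring = solve-∀

dot-⊖ˡ : ∀ {n} (u v w : Vec ℤ n) → (v ⊖ w) · u ≡ v · u - w · u
dot-⊖ˡ u v w rewrite dot-comm (v ⊖ w) u | dot-⊖ʳ u v w | dot-comm u v | dot-comm u w = refl

dot-⊛ˡ : ∀ {n} (u : Vec ℤ n) c v → (c ⊛ u) · v ≡ c * (u · v)
dot-⊛ˡ u c v rewrite dot-comm (c ⊛ u) v | dot-⊛ʳ v c u | dot-comm v u = refl

dot-++ : ∀ {m n} (a : Vec ℤ m) (b : Vec ℤ n) x y → (a ++ b) · (x ++ y) ≡ a · x + b · y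
dot-++ [] b [] y = sym (ℤP.+-identityˡ _)
dot-++ (a ∷ as) b (x ∷ xs) y rewrite dot-++ as b xs y = sym (ℤP.+-assoc (a * x) _ _)

zeroV-++ : ∀ {a b} → zeroV {a} ++ zeroV {b} ≡ zeroV
zeroV-++ {zero} = refl
zeroV-++ {suc a} = cong (0ℤ ∷_) (zeroV-++ {a})

dot-tabulate-zero : ∀ {n} (u : Vec ℤ n) → u · tabulate (λ _ → 0ℤ) ≡ 0ℤ
dot-tabulate-zero [] = refl
dot-tabulate-zero (a ∷ u) rewrite dot-tabulate-zero u | ℤP.*-zeroʳ a = refl

dot-e : ∀ {n} (u : Vec ℤ n) j → u · e j ≡ lookup u j
dot-e (a ∷ u) zero rewrite dot-tabulate-zero u | ℤP.*-identityʳ a = ℤP.+-identityʳ a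
dot-e (a ∷ u) (suc j) rewrite dot-e u j | ℤP.*-zeroʳ a = ℤP.+-identityˡ _

⊛-cancel : ∀ {n} c (x : Vec ℤ n) → ¬ c ≡ 0ℤ → c ⊛ x ≡ zeroV → x ≡ zeroV
⊛-cancel c [] c≢0 eq = refl
⊛-cancel c (a ∷ x) c≢0 eq with ℤP.i*j≡0⇒i≡0∨j≡0 c (VP.∷-injectiveˡ eq)
... | inj₁ c≡0 = ⊥-elim (c≢0 c≡0)
... | inj₂ a≡0 = cong₂ _∷_ a≡0 (⊛-cancel c x c≢0 (VP.∷-injectiveʳ eq))

0⊛ : ∀ {n} (x : Vec ℤ n) → 0ℤ ⊛ x ≡ zeroV
0⊛ [] = refl
0⊛ (a ∷ x) = cong₂ _∷_ (ℤP.*-zeroˡ a) (0⊛ x)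

0⊕ : ∀ {n} (x : Vec ℤ n) → zeroV ⊕ x ≡ x
0⊕ [] = refl
0⊕ (a ∷ x) = cong₂ _∷_ (ℤP.+-identityˡ a) (0⊕ x)

⊕-cancelʳ : ∀ {n} (u v w : Vec ℤ n) → u ⊕ v ≡ w ⊕ v → u ≡ w
⊕-cancelʳ [] [] [] _ = refl
⊕-cancelʳ (a ∷ u) (b ∷ v) (c ∷ w) eq =
  cong₂ _∷_ (+-cancelʳ b a c (VP.∷-injectiveˡ eq)) (⊕-cancelʳ u v w (VP.∷-injectiveʳ eq))

-- Positive definiteness: u · u is the sum of the squares ∣uᵢ∣², so it
-- vanishes only for u = 0.  This is what makes "orthogonal" arguments
-- work over ℤ.
norm² : ∀ {n} → Vec ℤ n → ℕ
norm² [] = 0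
norm² (a ∷ u) = ℤ.∣ a ∣ ℕ.* ℤ.∣ a ∣ ℕ.+ norm² u

dot-self≡norm² : ∀ {n} (u : Vec ℤ n) → u · u ≡ + norm² u
dot-self≡norm² [] = refl
dot-self≡norm² (a ∷ u) rewrite dot-self≡norm² u = cong (_+ + norm² u) (square a)
  where
  square : ∀ a → a * a ≡ + (ℤ.∣ a ∣ ℕ.* ℤ.∣ a ∣)
  square (+ zero) = refl
  square (+ suc n) = refl
  square -[1+ n ] = refl

norm²≡0⇒≡0 : ∀ {n} (u : Vec ℤ n) → norm² u ≡ 0 → u ≡ zeroV
norm²≡0⇒≡0 [] _ = refl
norm²≡0⇒≡0 (a ∷ u) eq = cong₂ _∷_ a≡0 (norm²≡0⇒≡0 u (ℕP.m+n≡0⇒n≡0 _ eq))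
  where
  a≡0 : a ≡ 0ℤ
  a≡0 = ℤP.∣i∣≡0⇒i≡0 ([ id , id ]′ (ℕP.m*n≡0⇒m≡0∨n≡0 _ (ℕP.m+n≡0⇒m≡0 _ eq)))

dot-self≡0⇒≡0 : ∀ {n} (u : Vec ℤ n) → u · u ≡ 0ℤ → u ≡ zeroV
dot-self≡0⇒≡0 u eq = norm²≡0⇒≡0 u (ℤP.+-injective (trans (sym (dot-self≡norm² u)) eq))

col : ∀ {k s} → (Fin k → Vec ℤ s) → Fin s → Vec ℤ k
col w i = tabulate (λ k → lookup (w k) i)

lookup-linComb : ∀ {k s} (c : Vec ℤ k) (w : Fin k → Vec ℤ s) i →
  lookup (linComb c w) i ≡ col w i · c
lookup-linComb [] w i = VP.lookup-replicate i 0ℤ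
lookup-linComb (c ∷ cs) w i
  rewrite VP.lookup-zipWith _+_ i (c ⊛ w zero) (linComb cs (λ j → w (suc j)))
        | VP.lookup-map i (c *_) (w zero)
        | lookup-linComb cs (λ j → w (suc j)) i
        | ℤP.*-comm c (lookup (w zero) i) = refl

dot-linComb : ∀ {k s} (y : Vec ℤ s) (c : Vec ℤ k) (w : Fin k → Vec ℤ s) →
  (∀ i → y · w i ≡ 0ℤ) → y · linComb c w ≡ 0ℤ
dot-linComb y [] w h = dot-zeroʳ y
dot-linComb y (c ∷ cs) w h
  rewrite dot-⊕ʳ y (c ⊛ w zero) (linComb cs (λ i → w (suc i)))
        | dot-⊛ʳ y c (w zero) | h zero
        | dot-linComb y cs (λ i → w (suc i)) (λ i → h (suc i))
        | ℤP.*-zeroʳ c = refl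

Solves : ∀ {n} → List (Vec ℤ n) → Vec ℤ n → Set
Solves E x = All (λ a → a · x ≡ 0ℤ) E

data Pivot {n} (E : List (Vec ℤ (suc n))) : Set where
  no-pivot : All (λ a → V.head a ≡ 0ℤ) E → Pivot E
  pivot    : (p : Vec ℤ (suc n)) (rest : List (Vec ℤ (suc n))) →
             ¬ V.head p ≡ 0ℤ → L.length E ≡ suc (L.length rest) →
             (∀ x → Solves (p L.∷ rest) x → Solves E x) → Pivot E

find-pivot : ∀ {n} (E : List (Vec ℤ (suc n))) → Pivot E
find-pivot L.[] = no-pivot []
find-pivot (a L.∷ E) with V.head a ℤ.≟ 0ℤ
... | no a₀≢0 = pivot a E a₀≢0 refl (λ x sol → sol)
... | yes a₀≡0 with find-pivot E
...   | no-pivot zs = no-pivot (a₀≡0 ∷ zs)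
...   | pivot p rest p₀≢0 len sound =
          pivot p (a L.∷ rest) p₀≢0 (cong suc len)
                (λ { x (sp ∷ sa ∷ sr) → sa ∷ sound x (sp ∷ sr) })

-- Gaussian elimination step: the combination p₀·a − a₀·p of two equations,
-- with the (vanishing) leading coefficient dropped.
eliminate : ∀ {n} → Vec ℤ (suc n) → Vec ℤ (suc n) → Vec ℤ n
eliminate (p₀ ∷ p') (a₀ ∷ a') = (p₀ ⊛ a') ⊖ (a₀ ⊛ p')

back-substitute : ∀ {n} → Vec ℤ (suc n) → Vec ℤ n → Vec ℤ (suc n)
back-substitute (p₀ ∷ p') x = (- (p' · x)) ∷ (p₀ ⊛ x)

back-substitute-pivot : ∀ {n} (p : Vec ℤ (suc n)) (x : Vec ℤ n) →
  p · back-substitute p x ≡ 0ℤ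
back-substitute-pivot (p₀ ∷ p') x =
  trans (cong (λ z → p₀ * (- (p' · x)) + z) (dot-⊛ʳ p' p₀ x)) (ring p₀ (p' · x))
  where
  ring : ∀ a b → a * (- b) + a * b ≡ 0ℤ
  ring = solve-∀

back-substitute-sound : ∀ {n} (p a : Vec ℤ (suc n)) (x : Vec ℤ n) →
  eliminate p a · x ≡ 0ℤ → a · back-substitute p x ≡ 0ℤ
back-substitute-sound (p₀ ∷ p') (a₀ ∷ a') x h = begin
  a₀ * (- (p' · x)) + a' · (p₀ ⊛ x)  ≡⟨ cong (λ z → a₀ * (- (p' · x)) + z) (dot-⊛ʳ a' p₀ x) ⟩
  a₀ * (- (p' · x)) + p₀ * (a' · x)  ≡⟨ ring a₀ p₀ (p' · x) (a' · x) ⟩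
  p₀ * (a' · x) - a₀ * (p' · x)      ≡⟨ sym (cong₂ _-_ (dot-⊛ˡ a' p₀ x) (dot-⊛ˡ p' a₀ x)) ⟩
  (p₀ ⊛ a') · x - (a₀ ⊛ p') · x      ≡⟨ sym (dot-⊖ˡ x (p₀ ⊛ a') (a₀ ⊛ p')) ⟩
  eliminate (p₀ ∷ p') (a₀ ∷ a') · x  ≡⟨ h ⟩
  0ℤ                                 ∎
  where
  open ≡-Reasoning
  ring : ∀ a p P A → a * (- P) + p * A ≡ p * A - a * P
  ring = solve-∀

back-substitute≢0 : ∀ {n} (p : Vec ℤ (suc n)) (x : Vec ℤ n) →
  ¬ V.head p ≡ 0ℤ → ¬ x ≡ zeroV → ¬ back-substitute p x ≡ zeroV
back-substitute≢0 (p₀ ∷ p') x p₀≢0 x≢0 eq = x≢0 (⊛-cancel p₀ x p₀≢0 (VP.∷-injectiveʳ eq))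

nonzero-solution : ∀ n (E : List (Vec ℤ n)) → L.length E ℕ.< n →
  ∃[ x ] (¬ x ≡ zeroV × Solves E x)
nonzero-solution zero E ()
nonzero-solution (suc n) E lt with find-pivot E
... | no-pivot zs = (1ℤ ∷ zeroV) , (λ ()) , solve-first E zs
  where
  solve-first : ∀ E → All (λ a → V.head a ≡ 0ℤ) E → Solves E (1ℤ ∷ zeroV)
  solve-first L.[] [] = []
  solve-first ((a₀ ∷ a') L.∷ E) (a₀≡0 ∷ zs) = eq ∷ solve-first E zs
    where
    eq : (a₀ ∷ a') · (1ℤ ∷ zeroV) ≡ 0ℤ
    eq rewrite a₀≡0 | dot-zeroʳ a' = refl
... | pivot p rest p₀≢0 len sound
  with nonzero-solution n (L.map (eliminate p) rest) shorter
  where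
  shorter : L.length (L.map (eliminate p) rest) ℕ.< n
  shorter rewrite LP.length-map (eliminate p) rest = ℕ.s≤s⁻¹ (subst (ℕ._< suc n) len lt)
...   | x , x≢0 , sol = back-substitute p x , lifted≢0 ,
                        sound _ (back-substitute-pivot p x ∷ lift-all rest (AllP.map⁻ sol))
  where
  lifted≢0 : ¬ back-substitute p x ≡ zeroV
  lifted≢0 = back-substitute≢0 p x p₀≢0 x≢0
  lift-all : ∀ R → All (λ a → eliminate p a · x ≡ 0ℤ) R → Solves R (back-substitute p x)
  lift-all L.[] [] = []
  lift-all (a L.∷ R) (s ∷ ss) = back-substitute-sound p a x s ∷ lift-all R ss

-- At most n vectors of ℤⁿ are linearly independent: otherwise the columns
-- give a homogeneous system with a nonzero solution, i.e. a dependence.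
independent⇒≤ : ∀ {k n} (w : Fin k → Vec ℤ n) → LinIndep w → k ℕ.≤ n
independent⇒≤ {k} {n} w ind with k ℕ.≤? n
... | yes k≤n = k≤n
... | no k≰n with nonzero-solution k (L.tabulate (col w)) few
  where
  few : L.length (L.tabulate (col w)) ℕ.< k
  few rewrite LP.length-tabulate (col w) = ℕP.≰⇒> k≰n
...   | c , c≢0 , sol = ⊥-elim (c≢0 (ind c (vec-ext-zero λ i →
          trans (lookup-linComb c w i) (AllP.tabulate⁻ sol i))))

extend : ∀ {k s} → Vec ℤ s → (Fin k → Vec ℤ s) → Fin (suc k) → Vec ℤ s
extend ρ w zero = ρ
extend ρ w (suc i) = w i

extend-independent : ∀ {k s} (w : Fin k → Vec ℤ s) → LinIndep w → (t ρ : Vec ℤ s) →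
  (∀ i → t · w i ≡ 0ℤ) → ¬ t · ρ ≡ 0ℤ → LinIndep (extend ρ w)
extend-independent w ind t ρ t⊥w t·ρ≢0 (c ∷ cs) eq = cong₂ _∷_ c≡0 cs≡0
  where
  open ≡-Reasoning
  c·tρ≡0 : c * (t · ρ) ≡ 0ℤ
  c·tρ≡0 = begin
    c * (t · ρ)                             ≡⟨ sym (ℤP.+-identityʳ _) ⟩
    c * (t · ρ) + 0ℤ                        ≡⟨ sym (cong₂ _+_ (dot-⊛ʳ t c ρ) (dot-linComb t cs w t⊥w)) ⟩
    t · (c ⊛ ρ) + t · linComb cs w          ≡⟨ sym (dot-⊕ʳ t (c ⊛ ρ) (linComb cs w)) ⟩
    t · linComb (c ∷ cs) (extend ρ w)       ≡⟨ cong (t ·_) eq ⟩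
    t · zeroV                               ≡⟨ dot-zeroʳ t ⟩
    0ℤ                                      ∎
  c≡0 : c ≡ 0ℤ
  c≡0 = [ id , (λ tρ≡0 → ⊥-elim (t·ρ≢0 tρ≡0)) ]′ (ℤP.i*j≡0⇒i≡0∨j≡0 c c·tρ≡0)
  cs≡0 : cs ≡ zeroV
  cs≡0 = ind cs (begin
    linComb cs w                      ≡⟨ sym (0⊕ _) ⟩
    zeroV ⊕ linComb cs w              ≡⟨ cong (_⊕ linComb cs w) (sym (0⊛ ρ)) ⟩
    (0ℤ ⊛ ρ) ⊕ linComb cs w           ≡⟨ cong (λ a → (a ⊛ ρ) ⊕ linComb cs w) (sym c≡0) ⟩
    linComb (c ∷ cs) (extend ρ w)     ≡⟨ eq ⟩
    zeroV                             ∎)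

row : ∀ {s} → Fin s → Fin s → Fin s → Fin s → Vec ℤ s
row j₁ j₂ j₃ j₄ = ((e j₁ ⊕ e j₂) ⊖ e j₃) ⊖ e j₄

dot-row : ∀ {s} (y : Vec ℤ s) j₁ j₂ j₃ j₄ →
  y · row j₁ j₂ j₃ j₄ ≡ (lookup y j₁ + lookup y j₂) - (lookup y j₃ + lookup y j₄)
dot-row y j₁ j₂ j₃ j₄
  rewrite dot-⊖ʳ y ((e j₁ ⊕ e j₂) ⊖ e j₃) (e j₄)
        | dot-⊖ʳ y (e j₁ ⊕ e j₂) (e j₃)
        | dot-⊕ʳ y (e j₁) (e j₂)
        | dot-e y j₁ | dot-e y j₂ | dot-e y j₃ | dot-e y j₄ =
    ring (lookup y j₁) (lookup y j₂) (lookup y j₃) (lookup y j₄)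
  where
  ring : ∀ a b c d → ((a + b) - c) - d ≡ (a + b) - (c + d)
  ring = solve-∀

⊥row⇒ : ∀ {s} (y : Vec ℤ s) j₁ j₂ j₃ j₄ → y · row j₁ j₂ j₃ j₄ ≡ 0ℤ →
  lookup y j₁ + lookup y j₂ ≡ lookup y j₃ + lookup y j₄
⊥row⇒ y j₁ j₂ j₃ j₄ h = ℤP.i-j≡0⇒i≡j _ _ (trans (sym (dot-row y j₁ j₂ j₃ j₄)) h)

⇒⊥row : ∀ {s} (y : Vec ℤ s) j₁ j₂ j₃ j₄ →
  lookup y j₁ + lookup y j₂ ≡ lookup y j₃ + lookup y j₄ → y · row j₁ j₂ j₃ j₄ ≡ 0ℤ
⇒⊥row y j₁ j₂ j₃ j₄ h =
  trans (dot-row y j₁ j₂ j₃ j₄) (trans (cong (_- (lookup y j₃ + lookup y j₄)) h) (ℤP.+-inverseʳ (lookup y j₃ + lookup y j₄)))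

𝟙 : ∀ {s} → Vec ℤ s
𝟙 = replicate _ 1ℤ

𝟙·𝟙 : ∀ s → 𝟙 {s} · 𝟙 ≡ + s
𝟙·𝟙 zero = refl
𝟙·𝟙 (suc s) rewrite 𝟙·𝟙 s = refl

𝟙⊥row : ∀ {s} (j₁ j₂ j₃ j₄ : Fin s) → 𝟙 · row j₁ j₂ j₃ j₄ ≡ 0ℤ
𝟙⊥row j₁ j₂ j₃ j₄ = ⇒⊥row 𝟙 j₁ j₂ j₃ j₄
  (cong₂ _+_ (trans (VP.lookup-replicate j₁ 1ℤ) (sym (VP.lookup-replicate j₃ 1ℤ)))
             (trans (VP.lookup-replicate j₂ 1ℤ) (sym (VP.lookup-replicate j₄ 1ℤ))))

module _ {s : ℕ} (U : SegmentUnion s) where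

  open SegmentUnion U

  Quad : Fin s → Fin s → Fin s → Fin s → Set
  Quad j₁ j₂ j₃ j₄ = ∃[ a₁ ] ∃[ a₂ ] ∃[ a₃ ] ∃[ a₄ ]
    (InP U j₁ a₁ × InP U j₂ a₂ × InP U j₃ a₃ × InP U j₄ a₄ × a₁ + a₂ ≡ a₃ + a₄)

  Respects : (Fin s → ℤ) → Set
  Respects t = ∀ j₁ j₂ j₃ j₄ → Quad j₁ j₂ j₃ j₄ → t j₁ + t j₂ ≡ t j₃ + t j₄

  respects⇒⊥rows : ∀ (y : Vec ℤ s) → Respects (lookup y) → ∀ ρ → RowSA U ρ → y · ρ ≡ 0ℤ
  respects⇒⊥rows y resp ρ (j₁ , j₂ , j₃ , j₄ , _ , quad , refl) =
    ⇒⊥row y j₁ j₂ j₃ j₄ (resp j₁ j₂ j₃ j₄ quad)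

  -- A vector orthogonal to the rows of S_A satisfies every relation with
  -- indices not all equal; relations with four equal indices are trivial.
  ⊥rows⇒relation : ∀ (y : Vec ℤ s) → (∀ ρ → RowSA U ρ → y · ρ ≡ 0ℤ) → ∀ j₁ j₂ j₃ j₄ →
    ¬ (j₁ ≡ j₂ × j₂ ≡ j₃ × j₃ ≡ j₄) → Quad j₁ j₂ j₃ j₄ →
    lookup y j₁ + lookup y j₂ ≡ lookup y j₃ + lookup y j₄
  ⊥rows⇒relation y ⊥rows j₁ j₂ j₃ j₄ distinct quad =
    ⊥row⇒ y j₁ j₂ j₃ j₄ (⊥rows _ (j₁ , j₂ , j₃ , j₄ , distinct , quad , refl))

  ⊥rows⇒respects : ∀ (y : Vec ℤ s) → (∀ ρ → RowSA U ρ → y · ρ ≡ 0ℤ) → Respects (lookup y)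
  ⊥rows⇒respects y ⊥rows j₁ j₂ j₃ j₄ quad
    with j₁ FinP.≟ j₂ | j₂ FinP.≟ j₃ | j₃ FinP.≟ j₄
  ... | yes refl | yes refl | yes refl = refl
  ... | no j₁≢j₂ | _ | _ = ⊥rows⇒relation y ⊥rows j₁ j₂ j₃ j₄ (λ (j₁≡j₂ , _) → j₁≢j₂ j₁≡j₂) quad
  ... | yes _ | no j₂≢j₃ | _ = ⊥rows⇒relation y ⊥rows j₁ j₂ j₃ j₄ (λ (_ , j₂≡j₃ , _) → j₂≢j₃ j₂≡j₃) quad
  ... | yes _ | yes _ | no j₃≢j₄ = ⊥rows⇒relation y ⊥rows j₁ j₂ j₃ j₄ (λ (_ , _ , j₃≡j₄) → j₃≢j₄ j₃≡j₄) quad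

  respects-cong : ∀ {t t′} → (∀ i → t i ≡ t′ i) → Respects t → Respects t′
  respects-cong {t} {t′} t≗t′ resp j₁ j₂ j₃ j₄ quad =
    subst₂ _≡_ (cong₂ _+_ (t≗t′ j₁) (t≗t′ j₂)) (cong₂ _+_ (t≗t′ j₃) (t≗t′ j₄)) (resp j₁ j₂ j₃ j₄ quad)

  respects-shift : ∀ t τ → Respects t → Respects (λ i → t i + τ)
  respects-shift t τ resp j₁ j₂ j₃ j₄ quad =
    trans (ring (t j₁) (t j₂) τ) (trans (cong (_+ (τ + τ)) (resp j₁ j₂ j₃ j₄ quad)) (sym (ring (t j₃) (t j₄) τ)))
    where
    ring : ∀ a b τ → (a + τ) + (b + τ) ≡ (a + b) + (τ + τ)
    ring = solve-∀

  𝟙⊥rows : ∀ ρ → RowSA U ρ → 𝟙 · ρ ≡ 0ℤ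
  𝟙⊥rows ρ (j₁ , j₂ , j₃ , j₄ , _ , _ , refl) = 𝟙⊥row j₁ j₂ j₃ j₄

  -- An independent family of r rows of S_A has r < s: all rows lie in 𝟙^⊥.
  rank<s : ∀ {r} (w : Fin r → Vec ℤ s) → (∀ i → RowSA U (w i)) → LinIndep w → 1 ≤ s → r ℕ.< s
  rank<s w rows ind (s≤s z≤n) = independent⇒≤ (extend 𝟙 w)
    (extend-independent w ind 𝟙 𝟙 (λ i → 𝟙⊥rows (w i) (rows i)) 𝟙·𝟙≢0)
    where
    𝟙·𝟙≢0 : ¬ 𝟙 {s} · 𝟙 ≡ 0ℤ
    𝟙·𝟙≢0 eq with ℤP.+-injective (trans (sym (𝟙·𝟙 s)) eq)
    ... | ()

  -- Orthogonality to a maximal independent family of rows of S_A implies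
  -- orthogonality to every row: otherwise the family could be extended.
  ⊥maximal⇒⊥rows : ∀ {r} (w : Fin r → Vec ℤ s) → (∀ i → RowSA U (w i)) → LinIndep w →
    (∀ (w' : Fin (suc r) → Vec ℤ s) → (∀ i → RowSA U (w' i)) → ¬ LinIndep w') →
    ∀ (t : Vec ℤ s) → (∀ k → w k · t ≡ 0ℤ) → ∀ ρ → RowSA U ρ → t · ρ ≡ 0ℤ
  ⊥maximal⇒⊥rows w rows ind maximal t w⊥t ρ ρ-row with t · ρ ℤ.≟ 0ℤ
  ... | yes t·ρ≡0 = t·ρ≡0
  ... | no t·ρ≢0 = ⊥-elim (maximal (extend ρ w) extended-rows
          (extend-independent w ind t ρ (λ k → trans (dot-comm t (w k)) (w⊥t k)) t·ρ≢0))
    where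
    extended-rows : ∀ i → RowSA U (extend ρ w i)
    extended-rows zero = ρ-row
    extended-rows (suc i) = rows i

  -- Some segment P_{i₀} has two consecutive points m₀ and 1 + m₀.
  i₀ : Fin s
  i₀ = proj₁ somelong

  m₀ : ℤ
  m₀ = m i₀

  left-end∈P : ∀ i → InP U i (m i)
  left-end∈P i = ℤP.≤-refl , m≤n i

  m₀+1∈P : InP U i₀ (1ℤ + m₀)
  m₀+1∈P = ℤP.i≤j+i m₀ 1ℤ , ℤP.i<j⇒suc[i]≤j (proj₂ somelong)

  FreimanHom : (ℤ → ℤ) → Set
  FreimanHom f = ∀ x y z t → InA U x → InA U y → InA U z → InA U t →
    x + y ≡ z + t → f x + f y ≡ f z + f t

  -- A Freiman homomorphism is affine on each segment, with one common slope
  -- read off at m₀, 1 + m₀, and intercepts depending on the segment.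
  slope : (ℤ → ℤ) → ℤ
  slope f = f (1ℤ + m₀) - f m₀

  intercept : (ℤ → ℤ) → Fin s → ℤ
  intercept f i = f (m i) - m i * slope f

  module _ (f : ℤ → ℤ) (hom : FreimanHom f) where

    -- x + (1 + m₀) = (1 + x) + m₀ forces f (1 + x) − f x = slope f.
    step : ∀ x → InA U x → InA U (1ℤ + x) → f (1ℤ + x) ≡ f x + slope f
    step x x∈A x+1∈A = ℤP.i-j≡0⇒i≡j _ _ (trans (ring (f x) (f (1ℤ + m₀)) (f (1ℤ + x)) (f m₀))
        (trans (cong (_- (f x + f (1ℤ + m₀))) (sym relation)) (ℤP.+-inverseʳ (f x + f (1ℤ + m₀)))))
      where
      relation : f x + f (1ℤ + m₀) ≡ f (1ℤ + x) + f m₀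
      relation = hom x (1ℤ + m₀) (1ℤ + x) m₀ x∈A (i₀ , m₀+1∈P) x+1∈A (i₀ , left-end∈P i₀)
        (ring′ x m₀)
        where
        ring′ : ∀ x m → x + (1ℤ + m) ≡ (1ℤ + x) + m
        ring′ = solve-∀
      ring : ∀ a b c d → c - (a + (b - d)) ≡ (c + d) - (a + b)
      ring = solve-∀

    walk : ∀ i k → m i + + k ℤ.≤ n i → f (m i + + k) ≡ f (m i) + + k * slope f
    walk i zero _ rewrite ℤP.+-identityʳ (m i) | ℤP.*-zeroˡ (slope f) = sym (ℤP.+-identityʳ _)
    walk i (suc k) y+1≤n = begin
      f (m i + + suc k)                 ≡⟨ cong f (shift (m i) (+ k)) ⟩
      f (1ℤ + y)                        ≡⟨ step y (i , mi≤y , y≤n) (i , mi≤y+1 , y+1≤n′) ⟩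
      f y + slope f                     ≡⟨ cong (_+ slope f) (walk i k y≤n) ⟩
      f (m i) + + k * slope f + slope f ≡⟨ ring (f (m i)) (+ k) (slope f) ⟩
      f (m i) + + suc k * slope f       ∎
      where
      open ≡-Reasoning
      y : ℤ
      y = m i + + k
      shift : ∀ a b → a + (1ℤ + b) ≡ 1ℤ + (a + b)
      shift = solve-∀
      ring : ∀ a k g → a + k * g + g ≡ a + (1ℤ + k) * g
      ring = solve-∀
      y+1≤n′ : 1ℤ + y ℤ.≤ n i
      y+1≤n′ = subst (ℤ._≤ n i) (shift (m i) (+ k)) y+1≤n
      y≤n : y ℤ.≤ n i
      y≤n = ℤP.≤-trans (ℤP.i≤j+i y 1ℤ) y+1≤n′
      mi≤y : m i ℤ.≤ y
      mi≤y = ℤP.i≤i+j (m i) (+ k)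
      mi≤y+1 : m i ℤ.≤ 1ℤ + y
      mi≤y+1 = ℤP.≤-trans mi≤y (ℤP.i≤j+i y 1ℤ)

    affine-on-segment : ∀ i x → InP U i x → f x ≡ intercept f i + x * slope f
    affine-on-segment i x (mi≤x , x≤n) = begin
      f x                                  ≡⟨ cong f x≡mi+k ⟩
      f (m i + + k)                        ≡⟨ walk i k (subst (ℤ._≤ n i) x≡mi+k x≤n) ⟩
      f (m i) + + k * slope f              ≡⟨ cong (λ z → f (m i) + z * slope f) k≡x-mi ⟩
      f (m i) + (x - m i) * slope f        ≡⟨ ring (f (m i)) (m i) x (slope f) ⟩
      intercept f i + x * slope f          ∎
      where
      open ≡-Reasoning
      k : ℕ
      k = ℤ.∣ x - m i ∣
      k≡x-mi : + k ≡ x - m i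
      k≡x-mi = ℤP.0≤i⇒+∣i∣≡i (ℤP.i≤j⇒0≤j-i mi≤x)
      x≡mi+k : x ≡ m i + + k
      x≡mi+k = trans (split x (m i)) (cong (λ z → m i + z) (sym k≡x-mi))
        where
        split : ∀ x m → x ≡ m + (x - m)
        split = solve-∀
      ring : ∀ a m x g → a + (x - m) * g ≡ (a - m * g) + x * g
      ring = solve-∀

    -- The intercepts respect A: the slope terms cancel in any relation.
    intercepts-respect : Respects (intercept f)
    intercepts-respect j₁ j₂ j₃ j₄ (a₁ , a₂ , a₃ , a₄ , p₁ , p₂ , p₃ , p₄ , a-rel) =
      ℤP.i-j≡0⇒i≡j _ _ (begin
        (C₁ + C₂) - (C₃ + C₄)                             ≡⟨ ring C₁ C₂ C₃ C₄ a₁ a₂ a₃ a₄ g ⟩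
        (F₁ + F₂ - (F₃ + F₄)) - (a₁ + a₂ - (a₃ + a₄)) * g  ≡⟨ cong₂ (λ u v → u - v * g) (zero-diff f-rel) (zero-diff a-rel) ⟩
        0ℤ - 0ℤ * g                                       ≡⟨ cong (λ z → 0ℤ - z) (ℤP.*-zeroˡ g) ⟩
        0ℤ                                                ∎)
      where
      open ≡-Reasoning
      g C₁ C₂ C₃ C₄ F₁ F₂ F₃ F₄ : ℤ
      g = slope f
      C₁ = intercept f j₁
      C₂ = intercept f j₂
      C₃ = intercept f j₃
      C₄ = intercept f j₄
      F₁ = C₁ + a₁ * g
      F₂ = C₂ + a₂ * g
      F₃ = C₃ + a₃ * g
      F₄ = C₄ + a₄ * g
      zero-diff : ∀ {a b} → a ≡ b → a - b ≡ 0ℤ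
      zero-diff {a} refl = ℤP.+-inverseʳ a
      f-rel : F₁ + F₂ ≡ F₃ + F₄
      f-rel = begin
        F₁ + F₂         ≡⟨ sym (cong₂ _+_ (affine-on-segment j₁ a₁ p₁) (affine-on-segment j₂ a₂ p₂)) ⟩
        f a₁ + f a₂     ≡⟨ hom a₁ a₂ a₃ a₄ (j₁ , p₁) (j₂ , p₂) (j₃ , p₃) (j₄ , p₄) a-rel ⟩
        f a₃ + f a₄     ≡⟨ cong₂ _+_ (affine-on-segment j₃ a₃ p₃) (affine-on-segment j₄ a₄ p₄) ⟩
        F₃ + F₄         ∎
      ring : ∀ C₁ C₂ C₃ C₄ a₁ a₂ a₃ a₄ g → (C₁ + C₂) - (C₃ + C₄) ≡
        ((C₁ + a₁ * g) + (C₂ + a₂ * g) - ((C₃ + a₃ * g) + (C₄ + a₄ * g))) - (a₁ + a₂ - (a₃ + a₄)) * g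
      ring = solve-∀

  data Admissible : ∀ {k} → Vec (Vec ℤ s) k → Set where
    [] : Admissible []
    cons : ∀ {k x} {T : Vec (Vec ℤ s) k} → ¬ x ≡ zeroV → 𝟙 · x ≡ 0ℤ → Respects (lookup x) →
           (∀ i → lookup T i · x ≡ 0ℤ) → Admissible T → Admissible (x ∷ T)

  admissible-respects : ∀ {k} {T : Vec (Vec ℤ s) k} → Admissible T → ∀ j₁ j₂ j₃ j₄ →
    Quad j₁ j₂ j₃ j₄ → col (lookup T) j₁ ⊕ col (lookup T) j₂ ≡ col (lookup T) j₃ ⊕ col (lookup T) j₄
  admissible-respects [] j₁ j₂ j₃ j₄ quad = refl
  admissible-respects (cons _ _ resp _ adm) j₁ j₂ j₃ j₄ quad =
    cong₂ _∷_ (resp j₁ j₂ j₃ j₄ quad) (admissible-respects adm j₁ j₂ j₃ j₄ quad)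

  -- An admissible family is linearly independent modulo 𝟙: pairing a
  -- relation Σ cₖ tₖ = κ 𝟙 with the first member t kills every other term.
  admissible-independent : ∀ {k} {T : Vec (Vec ℤ s) k} → Admissible T →
    ∀ c κ → linComb c (lookup T) ≡ κ ⊛ 𝟙 → c ≡ zeroV
  admissible-independent [] [] κ _ = refl
  admissible-independent {T = x ∷ T} (cons x≢0 𝟙⊥x _ T⊥x adm) (a ∷ c) κ eq =
    cong₂ _∷_ a≡0 (admissible-independent adm c κ rest)
    where
    open ≡-Reasoning
    L : Vec ℤ s
    L = linComb c (lookup T)
    x⊥L : x · L ≡ 0ℤ
    x⊥L = dot-linComb x c (lookup T) (λ i → trans (dot-comm x (lookup T i)) (T⊥x i))
    a·xx≡0 : a * (x · x) ≡ 0ℤ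
    a·xx≡0 = begin
      a * (x · x)             ≡⟨ sym (ℤP.+-identityʳ _) ⟩
      a * (x · x) + 0ℤ        ≡⟨ sym (cong₂ _+_ (dot-⊛ʳ x a x) x⊥L) ⟩
      x · (a ⊛ x) + x · L     ≡⟨ sym (dot-⊕ʳ x (a ⊛ x) L) ⟩
      x · ((a ⊛ x) ⊕ L)       ≡⟨ cong (x ·_) eq ⟩
      x · (κ ⊛ 𝟙)             ≡⟨ dot-⊛ʳ x κ 𝟙 ⟩
      κ * (x · 𝟙)             ≡⟨ cong (κ *_) (trans (dot-comm x 𝟙) 𝟙⊥x) ⟩
      κ * 0ℤ                  ≡⟨ ℤP.*-zeroʳ κ ⟩
      0ℤ                      ∎
    a≡0 : a ≡ 0ℤ
    a≡0 = [ id , (λ xx≡0 → ⊥-elim (x≢0 (dot-self≡0⇒≡0 x xx≡0))) ]′ (ℤP.i*j≡0⇒i≡0∨j≡0 a a·xx≡0)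
    rest : L ≡ κ ⊛ 𝟙
    rest = begin
      L                       ≡⟨ sym (0⊕ L) ⟩
      zeroV ⊕ L               ≡⟨ cong (_⊕ L) (sym (0⊛ x)) ⟩
      (0ℤ ⊛ x) ⊕ L            ≡⟨ cong (λ z → (z ⊛ x) ⊕ L) (sym a≡0) ⟩
      (a ⊛ x) ⊕ L             ≡⟨ eq ⟩
      κ ⊛ 𝟙                   ∎

  -- Given an admissible family T of size k, the map x ↦ (x, T at the segment
  -- of x) is a Freiman 2-isomorphism from A onto a set spanning ℤ^{1+k}.
  module Embedding {k} {T : Vec (Vec ℤ s) k} (adm : Admissible T) where

    profile : Fin s → Vec ℤ k
    profile = col (lookup T)

    -- The segment containing x (an arbitrary one when x ∉ A).
    seg : ℤ → Fin s
    seg x with FinP.any? (λ i → (m i ℤP.≤? x) ×-dec (x ℤP.≤? n i))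
    ... | yes (i , _) = i
    ... | no _ = i₀

    seg-correct : ∀ x → InA U x → InP U (seg x) x
    seg-correct x x∈A with FinP.any? (λ i → (m i ℤP.≤? x) ×-dec (x ℤP.≤? n i))
    ... | yes (_ , x∈Pi) = x∈Pi
    ... | no x∉A = ⊥-elim (x∉A x∈A)

    profile-seg : ∀ i x → InP U i x → profile (seg x) ≡ profile i
    profile-seg i x x∈Pi = ⊕-cancelʳ _ _ _ (admissible-respects adm (seg x) i i i
      (x , x , x , x , seg-correct x (i , x∈Pi) , x∈Pi , x∈Pi , x∈Pi , refl))

    embed : ℤ → Vec ℤ (suc k)
    embed x = x ∷ profile (seg x)

    image : Vec ℤ (suc k) → Set
    image b = ∃[ x ] (InA U x × embed x ≡ b)

    -- The first coordinate makes embed injective and reflects relations;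
    -- admissibility makes the profiles preserve them.
    embed-iso : FreimanIso2 (InA U) image embed
    embed-iso = (λ x x∈A → x , x∈A , refl)
              , (λ x y _ _ eq → VP.∷-injectiveˡ eq)
              , (λ b b∈image → b∈image)
              , λ x y z t x∈A y∈A z∈A t∈A →
                  (λ rel → cong₂ _∷_ rel (admissible-respects adm (seg x) (seg y) (seg z) (seg t)
                     (x , y , z , t , seg-correct x x∈A , seg-correct y y∈A ,
                      seg-correct z z∈A , seg-correct t t∈A , rel)))
                , VP.∷-injectiveˡ

    -- If c₀ x + c · profile(i) = κ on A, the two consecutive points force
    -- c₀ = 0, and then c · profile(i) = κ for all i forces c = 0.
    image-spans : ¬ InHyperplane image
    image-spans (c₀ ∷ c , κ , c≢0 , on-plane) = c≢0 (cong₂ _∷_ c₀≡0 c≡0)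
      where
      plane : ∀ i x → InP U i x → c₀ * x + c · profile i ≡ κ
      plane i x x∈Pi = trans (cong (λ z → c₀ * x + c · z) (sym (profile-seg i x x∈Pi)))
                             (on-plane (embed x) (x , (i , x∈Pi) , refl))
      c₀≡0 : c₀ ≡ 0ℤ
      c₀≡0 = trans (ring c₀ m₀ (c · profile i₀))
        (trans (cong₂ _-_ (plane i₀ (1ℤ + m₀) m₀+1∈P) (plane i₀ m₀ (left-end∈P i₀))) (ℤP.+-inverseʳ κ))
        where
        ring : ∀ c m K → c ≡ (c * (1ℤ + m) + K) - (c * m + K)
        ring = solve-∀
      level : ∀ i → c · profile i ≡ κ
      level i = trans (sym (trans (cong (λ z → z * m i + c · profile i) c₀≡0) (ℤP.+-identityˡ _)))
                      (plane i (m i) (left-end∈P i))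
      c≡0 : c ≡ zeroV
      c≡0 = admissible-independent adm c κ (vec-ext λ i → begin
        lookup (linComb c (lookup T)) i   ≡⟨ lookup-linComb c (lookup T) i ⟩
        profile i · c                     ≡⟨ dot-comm (profile i) c ⟩
        c · profile i                     ≡⟨ level i ⟩
        κ                                 ≡⟨ sym (ℤP.*-identityʳ κ) ⟩
        κ * 1ℤ                            ≡⟨ cong (κ *_) (sym (VP.lookup-replicate i 1ℤ)) ⟩
        κ * lookup 𝟙 i                    ≡⟨ sym (VP.lookup-map i (κ *_) 𝟙) ⟩
        lookup (κ ⊛ 𝟙) i                  ∎)
        where open ≡-Reasoning

    realizable : Realizable (InA U) (suc k)
    realizable = image , image-spans , embed , embed-iso

  module _ {r} (w : Fin r → Vec ℤ s) (rows : ∀ i → RowSA U (w i)) (ind : LinIndep w)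
           (maximal : ∀ (w' : Fin (suc r) → Vec ℤ s) → (∀ i → RowSA U (w' i)) → ¬ LinIndep w')
           where

    -- Admissible families of every size k with k + r < s exist: a new member
    -- is a nonzero solution of the 1 + r + k equations 𝟙 · x = 0, wᵢ · x = 0
    -- and t · x = 0 for the members t already chosen.
    admissible-family : ∀ k → k ℕ.+ r ℕ.< s → Σ (Vec (Vec ℤ s) k) Admissible
    admissible-family zero _ = [] , []
    admissible-family (suc k) lt with admissible-family k (ℕP.<-trans (ℕP.n<1+n _) lt)
    ... | T , adm with nonzero-solution s (𝟙 L.∷ (L.tabulate w L.++ L.tabulate (lookup T))) few
      where
      few : L.length (𝟙 L.∷ (L.tabulate w L.++ L.tabulate (lookup T))) ℕ.< s
      few rewrite LP.length-++ (L.tabulate w) {L.tabulate (lookup T)}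
                | LP.length-tabulate w | LP.length-tabulate (lookup T) | ℕP.+-comm r k = lt
    ...   | x , x≢0 , (𝟙⊥x ∷ sol) = (x ∷ T) , cons x≢0 𝟙⊥x x-respects T⊥x adm
      where
      w⊥x : ∀ i → w i · x ≡ 0ℤ
      w⊥x = AllP.tabulate⁻ (AllP.++⁻ˡ (L.tabulate w) sol)
      T⊥x : ∀ i → lookup T i · x ≡ 0ℤ
      T⊥x = AllP.tabulate⁻ (AllP.++⁻ʳ (L.tabulate w) sol)
      x-respects : Respects (lookup x)
      x-respects = ⊥rows⇒respects x (⊥maximal⇒⊥rows w rows ind maximal x w⊥x)

    -- Lower bound: an admissible family of size s − r − 1 gives a Freiman
    -- copy of A spanning ℤ^{s−r}.
    lower-bound : 1 ≤ s → Realizable (InA U) (s ∸ r)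
    lower-bound 1≤s = subst (Realizable (InA U)) (sym s∸r≡1+d) (Embedding.realizable (proj₂ family))
      where
      r<s : r ℕ.< s
      r<s = rank<s w rows ind 1≤s
      d : ℕ
      d = s ∸ suc r
      s∸r≡1+d : s ∸ r ≡ suc d
      s∸r≡1+d = ℕP.+-∸-assoc 1 r<s
      family : Σ (Vec (Vec ℤ s) d) Admissible
      family = admissible-family d
        (subst (suc (d ℕ.+ r) ℕ.≤_) (ℕP.m∸n+n≡m r<s) (ℕP.≤-reflexive (sym (ℕP.+-suc d r))))

  -- Let φ : A → B ⊂ ℤ^d be a Freiman isomorphism, B spanning,
  -- and w any r independent rows of S_A.  On Pᵢ, φ(x) = qᵢ + x v.  A nonzero
  -- solution (c, λ, τ) ∈ ℤ^{d+r+1} of the s + 1 equations  c · v = 0,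
  -- c · qᵢ + Σₖ λₖ (wₖ)ᵢ + τ = 0  would put B in the hyperplane c · b = −τ.
  -- Hence s + 1 ≥ d + r + 1.
  module UpperBound {r} (w : Fin r → Vec ℤ s) (rows : ∀ i → RowSA U (w i)) (ind : LinIndep w)
                    {d} (B : Vec ℤ d → Set) (spans : ¬ InHyperplane B) (φ : ℤ → Vec ℤ d)
                    (iso : FreimanIso2 (InA U) B φ) where

    dot-hom : ∀ c → FreimanHom (λ x → c · φ x)
    dot-hom c x y z t x∈A y∈A z∈A t∈A rel =
      trans (sym (dot-⊕ʳ c (φ x) (φ y)))
        (trans (cong (c ·_) (proj₁ (proj₂ (proj₂ (proj₂ iso)) x y z t x∈A y∈A z∈A t∈A) rel))
               (dot-⊕ʳ c (φ z) (φ t)))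

    -- φ(x) = q i + x v on Pᵢ, with the common step v and offsets qᵢ.
    v : Vec ℤ d
    v = φ (1ℤ + m₀) ⊖ φ m₀

    q : Fin s → Vec ℤ d
    q i = φ (m i) ⊖ (m i ⊛ v)

    intercept-dot : ∀ c i → intercept (λ x → c · φ x) i ≡ c · q i
    intercept-dot c i = sym (trans (dot-⊖ʳ c (φ (m i)) (m i ⊛ v))
      (cong (λ z → c · φ (m i) - z) (trans (dot-⊛ʳ c (m i) v) (cong (m i *_) (dot-⊖ʳ c _ _)))))

    slope-dot : ∀ c → slope (λ x → c · φ x) ≡ c · v
    slope-dot c = sym (dot-⊖ʳ c (φ (1ℤ + m₀)) (φ m₀))

    -- The equations c · v = 0 and c · qᵢ + Σₖ λₖ (wₖ)ᵢ + τ = 0 on the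
    -- unknowns c ++ λ ++ [τ].
    system : List (Vec ℤ (d ℕ.+ (r ℕ.+ 1)))
    system = (v ++ (zeroV ++ 0ℤ ∷ [])) L.∷ L.tabulate (λ i → q i ++ (col w i ++ 1ℤ ∷ []))

    dot-unknowns : ∀ (a c : Vec ℤ d) (b λ′ : Vec ℤ r) x τ →
      (a ++ (b ++ x ∷ [])) · (c ++ (λ′ ++ τ ∷ [])) ≡ a · c + (b · λ′ + x * τ)
    dot-unknowns a c b λ′ x τ = trans (dot-++ a _ c _)
      (cong (λ z → a · c + z) (trans (dot-++ b _ λ′ _) (cong (λ z → b · λ′ + z) (ℤP.+-identityʳ (x * τ)))))

    module Solution (c : Vec ℤ d) (λ′ : Vec ℤ r) (τ : ℤ)
                    (sol : Solves system (c ++ (λ′ ++ τ ∷ []))) where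

      open ≡-Reasoning

      flat : c · v ≡ 0ℤ
      flat = begin
        c · v                                    ≡⟨ sym (ℤP.+-identityʳ _) ⟩
        c · v + 0ℤ                               ≡⟨ cong₂ (λ a b → a + (b + 0ℤ * τ)) (dot-comm c v) (sym (dot-zeroˡ λ′)) ⟩
        v · c + (zeroV · λ′ + 0ℤ * τ)            ≡⟨ sym (dot-unknowns v c zeroV λ′ 0ℤ τ) ⟩
        (v ++ (zeroV ++ 0ℤ ∷ [])) · (c ++ (λ′ ++ τ ∷ [])) ≡⟨ All.head sol ⟩
        0ℤ                                       ∎

      balance : ∀ i → c · q i + (col w i · λ′ + τ) ≡ 0ℤ
      balance i = begin
        c · q i + (col w i · λ′ + τ)             ≡⟨ cong₂ (λ a b → a + (col w i · λ′ + b)) (dot-comm c (q i)) (sym (ℤP.*-identityˡ τ)) ⟩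
        q i · c + (col w i · λ′ + 1ℤ * τ)        ≡⟨ sym (dot-unknowns (q i) c (col w i) λ′ 1ℤ τ) ⟩
        (q i ++ (col w i ++ 1ℤ ∷ [])) · (c ++ (λ′ ++ τ ∷ [])) ≡⟨ AllP.tabulate⁻ (All.tail sol) i ⟩
        0ℤ                                       ∎

      -- Yᵢ = c · qᵢ + τ is a shifted intercept vector, hence respects A …
      Y : Vec ℤ s
      Y = tabulate (λ i → c · q i + τ)

      Y-respects : Respects (lookup Y)
      Y-respects = respects-cong (λ i → sym (VP.lookup∘tabulate _ i))
        (respects-shift (λ i → c · q i) τ
          (respects-cong (intercept-dot c) (intercepts-respect (λ x → c · φ x) (dot-hom c))))

      -- … while the equations say Y = −Σ λₖ wₖ lies in the row space.
      Y-combination : linComb λ′ w ≡ -1ℤ ⊛ Y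
      Y-combination = vec-ext λ i → begin
        lookup (linComb λ′ w) i                   ≡⟨ lookup-linComb λ′ w i ⟩
        col w i · λ′                              ≡⟨ ring (c · q i) (col w i · λ′) τ ⟩
        (c · q i + (col w i · λ′ + τ)) - (c · q i + τ) ≡⟨ cong (_- (c · q i + τ)) (balance i) ⟩
        0ℤ - (c · q i + τ)                        ≡⟨ ℤP.+-identityˡ _ ⟩
        - (c · q i + τ)                           ≡⟨ sym (ℤP.-1*i≡-i _) ⟩
        -1ℤ * (c · q i + τ)                       ≡⟨ cong (-1ℤ *_) (sym (VP.lookup∘tabulate _ i)) ⟩
        -1ℤ * lookup Y i                          ≡⟨ sym (VP.lookup-map i (-1ℤ *_) Y) ⟩
        lookup (-1ℤ ⊛ Y) i                        ∎
        where
        ring : ∀ Q X τ → X ≡ (Q + (X + τ)) - (Q + τ)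
        ring = solve-∀

      -- So Y is orthogonal to itself, hence zero.
      Y≡0 : Y ≡ zeroV
      Y≡0 = dot-self≡0⇒≡0 Y ([ (λ ()) , id ]′ (ℤP.i*j≡0⇒i≡0∨j≡0 -1ℤ (begin
        -1ℤ * (Y · Y)        ≡⟨ sym (dot-⊛ʳ Y -1ℤ Y) ⟩
        Y · (-1ℤ ⊛ Y)        ≡⟨ cong (Y ·_) (sym Y-combination) ⟩
        Y · linComb λ′ w     ≡⟨ dot-linComb Y λ′ w (λ k → respects⇒⊥rows Y Y-respects (w k) (rows k)) ⟩
        0ℤ                   ∎)))

      intercept-level : ∀ i → c · q i + τ ≡ 0ℤ
      intercept-level i = trans (sym (VP.lookup∘tabulate _ i))
        (trans (cong (λ u → lookup u i) Y≡0) (VP.lookup-replicate i 0ℤ))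

      λ≡0 : λ′ ≡ zeroV
      λ≡0 = ind λ′ (trans Y-combination (trans (cong (-1ℤ ⊛_) Y≡0) (VP.map-replicate (-1ℤ *_) 0ℤ s)))

      on-plane : ∀ b → B b → c · b ≡ - τ
      on-plane b b∈B with proj₁ (proj₂ (proj₂ iso)) b b∈B
      ... | x , (i , x∈Pi) , refl = begin
        c · φ x                                  ≡⟨ affine-on-segment (λ y → c · φ y) (dot-hom c) i x x∈Pi ⟩
        intercept (λ y → c · φ y) i + x * slope (λ y → c · φ y)
                                                 ≡⟨ cong₂ (λ a g → a + x * g) (intercept-dot c i) (trans (slope-dot c) flat) ⟩
        c · q i + x * 0ℤ                         ≡⟨ cong (λ z → c · q i + z) (ℤP.*-zeroʳ x) ⟩
        c · q i + 0ℤ                             ≡⟨ ℤP.+-identityʳ _ ⟩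
        c · q i                                  ≡⟨ ring (c · q i) τ ⟩
        (c · q i + τ) - τ                        ≡⟨ cong (_- τ) (intercept-level i) ⟩
        0ℤ - τ                                   ≡⟨ ℤP.+-identityˡ _ ⟩
        - τ                                      ∎
        where
        ring : ∀ Q τ → Q ≡ (Q + τ) - τ
        ring = solve-∀

      -- As B spans, c = 0; then τ = 0 and the solution is trivial.
      trivial : c ++ (λ′ ++ τ ∷ []) ≡ zeroV
      trivial with VP.≡-dec ℤ._≟_ c zeroV
      ... | no c≢0 = ⊥-elim (spans (c , - τ , c≢0 , on-plane))
      ... | yes c≡0 = begin
        c ++ (λ′ ++ τ ∷ [])                 ≡⟨ cong₂ (λ u l → u ++ (l ++ τ ∷ [])) c≡0 λ≡0 ⟩
        zeroV {d} ++ (zeroV {r} ++ τ ∷ [])  ≡⟨ cong (λ u → zeroV {d} ++ (zeroV {r} ++ u ∷ [])) τ≡0 ⟩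
        zeroV {d} ++ (zeroV {r} ++ 0ℤ ∷ []) ≡⟨ cong (zeroV {d} ++_) (zeroV-++ {r} {1}) ⟩
        zeroV {d} ++ zeroV                  ≡⟨ zeroV-++ {d} ⟩
        zeroV                               ∎
        where
        τ≡0 : τ ≡ 0ℤ
        τ≡0 = begin
          τ                  ≡⟨ sym (ℤP.+-identityˡ τ) ⟩
          0ℤ + τ             ≡⟨ cong (_+ τ) (sym (dot-zeroˡ (q i₀))) ⟩
          zeroV · q i₀ + τ   ≡⟨ cong (λ u → u · q i₀ + τ) (sym c≡0) ⟩
          c · q i₀ + τ       ≡⟨ intercept-level i₀ ⟩
          0ℤ                 ∎

    -- If d > s − r, the s + 1 equations in d + r + 1 unknowns have a nonzero
    -- solution, contradicting triviality.
    upper-bound : d ≤ s ∸ r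
    upper-bound with d ℕ.≤? s ∸ r
    ... | yes d≤s∸r = d≤s∸r
    ... | no d≰s∸r with nonzero-solution (d ℕ.+ (r ℕ.+ 1)) system few
      where
      few : L.length system ℕ.< d ℕ.+ (r ℕ.+ 1)
      few rewrite LP.length-tabulate (λ i → q i ++ (col w i ++ 1ℤ ∷ [])) | ℕP.+-comm r 1 | ℕP.+-suc d r =
        s≤s (ℕP.≤-trans (s≤s (subst (s ℕ.≤_) (ℕP.+-comm r (s ∸ r)) (ℕP.m≤n+m∸n s r)))
                        (ℕP.+-monoˡ-≤ r (ℕP.≰⇒> d≰s∸r)))
    ...   | z , z≢0 , sol with V.splitAt d z
    ...     | c , rest , refl with V.splitAt r rest
    ...       | λ′ , τ ∷ [] , refl = ⊥-elim (z≢0 (Solution.trivial c λ′ τ sol))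

corollary1 : (s : ℕ) (U : SegmentUnion s) →
    1 ≤ s → s ≤ card U ∸ 1 →
    (r : ℕ) → IsRank (RowSA U) r →
    IsDim (InA U) (s ∸ r)
corollary1 s U 1≤s _ r ((w , rows , ind) , maximal) =
    lower-bound U w rows ind maximal 1≤s
  , λ d (B , spans , φ , iso) → UpperBound.upper-bound U w rows ind B spans φ iso
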